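{- Let $s,t$ be positive integers and $\delta,\delta_1$ positive reals, and let $\ell=\lfloor N_1(s,t,\delta,\delta_1)\rfloor$, where \[ N_1(s,t,\delta,\delta_1):= \begin{cases} (\delta-s)\left(\binom{\lfloor \delta_1\rfloor}{s-1}(t-1)+\tfrac12 \delta_1\right)+\delta &\text{if } s>2,\\ \tfrac12 (\delta -2)\delta_1t+\delta &\text{if } s=2,\\ t-1&\text{if } s=1. \end{cases} \] Let $G$ be a graph such that every subgraph of $G$ has average degree at most $\delta$, and every graph whose exact $1$-subdivision is a subgraph of $G$ has average degree at most $\delta_1$. Then at least one of the following holds: (i) $G$ contains $K^*_{s,t}$ as a subgraph; (ii) $G$ has a vertex of degree at most $s-1$; (iii) $G$ has an $\ell$-light edge.
   Context: For integers $s,t\ge 1$, $K^*_{s,t}$ is the bipartite graph obtained from the complete bipartite graph $K_{s,t}$ by adding $\binom{s}{2}$ new vertices, each adjacent to a distinct pair of vertices in the part of $K_{s,t}$ of size $s$. The exact $1$-subdivision of a graph is obtained by subdividing every edge exactly once. An edge is $\ell$-light if both of its endpoints have degree at most $\ell$.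
   Formalization: The parameters $\delta$ and $\delta_1$ range over the positive rationals rather than the positive reals. -}

module Defs where

open import Data.Nat as ℕ using (ℕ; zero; suc)
open import Data.Nat.Combinatorics using (_C_)
open import Data.Integer as ℤ using (ℤ; +_; ∣_∣)
open import Data.Rational as ℚ using (ℚ; _/_; ½; floor)
open import Data.Bool using (Bool; true; false; if_then_else_)
open import Data.Fin using (Fin)
open import Data.List using (List; map; allFin)
open import Data.Nat.ListAction using (sum)
open import Data.Product using (Σ; _×_; ∃; ∃-syntax; _,_)
open import Relation.Binary.PropositionalEquality using (_≡_)
open import Function.Definitions using (Injective)

record Graph (n : ℕ) : Set where
  field
    adj    : Fin n → Fin n → Bool
    sym    : ∀ i j → adj i j ≡ adj j i
    irrefl : ∀ i → adj i i ≡ false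
open Graph public

_~[_]_ : ∀ {n} → Fin n → Graph n → Fin n → Set
i ~[ G ] j = adj G i j ≡ true

degree : ∀ {n} → Graph n → Fin n → ℕ
degree {n} G i = sum (map (λ j → if adj G i j then 1 else 0) (allFin n))

degSum : ∀ {n} → Graph n → ℕ
degSum {n} G = sum (map (degree G) (allFin n))

ℕ→ℚ : ℕ → ℚ
ℕ→ℚ k = + k / 1

-- "H has average degree at most δ":  (Σ_v deg v) / |V(H)| ≤ δ,
-- written without division as Σ_v deg v ≤ δ · |V(H)|.
AvgDegAtMost : ∀ {m} → Graph m → ℚ → Set
AvgDegAtMost {m} H δ = ℕ→ℚ (degSum H) ℚ.≤ δ ℚ.* ℕ→ℚ m

Contains : ∀ {n} (G : Graph n) {V : Set} (R : V → V → Set) → Set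
Contains {n} G {V} R =
  Σ (V → Fin n) λ f → Injective _≡_ _≡_ f × (∀ u v → R u v → f u ~[ G ] f v)

_⊆G_ : ∀ {m n} → Graph m → Graph n → Set
H ⊆G G = Contains G (λ a b → a ~[ H ] b)

-- The exact 1-subdivision of H: original vertices plus one new vertex for
-- each edge {a,b} of H (recorded with a < b); the new vertex is adjacent
-- exactly to a and b.
data SubdivV {m : ℕ} (H : Graph m) : Set where
  orig : Fin m → SubdivV H
  mid  : (a b : Fin m) → a Data.Fin.< b → a ~[ H ] b → SubdivV H

data SubdivE {m : ℕ} (H : Graph m) : SubdivV H → SubdivV H → Set where
  left₁  : ∀ a b p e → SubdivE H (orig a) (mid a b p e)
  left₂  : ∀ a b p e → SubdivE H (mid a b p e) (orig a)
  right₁ : ∀ a b p e → SubdivE H (orig b) (mid a b p e)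
  right₂ : ∀ a b p e → SubdivE H (mid a b p e) (orig b)

SubdivisionIn : ∀ {m n} → Graph m → Graph n → Set
SubdivisionIn H G = Contains G (SubdivE H)

-- K*_{s,t}: parts A (size s) and B (size t) completely joined, plus one new
-- vertex Cv i j for each pair i < j in A, adjacent to i and j.
data KStarV (s t : ℕ) : Set where
  A : Fin s → KStarV s t
  B : Fin t → KStarV s t
  Cv : (i j : Fin s) → i Data.Fin.< j → KStarV s t

data KStarE (s t : ℕ) : KStarV s t → KStarV s t → Set where
  ab  : ∀ i j → KStarE s t (A i) (B j)
  ba  : ∀ i j → KStarE s t (B j) (A i)
  ci₁ : ∀ i j p → KStarE s t (Cv i j p) (A i)
  ci₂ : ∀ i j p → KStarE s t (A i) (Cv i j p)
  cj₁ : ∀ i j p → KStarE s t (Cv i j p) (A j)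
  cj₂ : ∀ i j p → KStarE s t (A j) (Cv i j p)

ContainsKStar : ∀ {n} → Graph n → ℕ → ℕ → Set
ContainsKStar G s t = Contains G (KStarE s t)

-- N₁(s,t,δ,δ₁).  For s = 0 (excluded by hypothesis) the value is arbitrary.
N₁ : ℕ → ℕ → ℚ → ℚ → ℚ
N₁ zero t δ δ₁ = ℕ→ℚ t ℚ.- ℚ.1ℚ
N₁ (suc zero) t δ δ₁ = ℕ→ℚ t ℚ.- ℚ.1ℚ
N₁ (suc (suc zero)) t δ δ₁ = ½ ℚ.* (δ ℚ.- ℕ→ℚ 2) ℚ.* δ₁ ℚ.* ℕ→ℚ t ℚ.+ δ
N₁ s@(suc (suc (suc k))) t δ δ₁ =
  (δ ℚ.- ℕ→ℚ s)
    ℚ.* (ℕ→ℚ ((∣ floor δ₁ ∣ C (suc (suc k))) ℕ.* (t ℕ.∸ 1)) ℚ.+ ½ ℚ.* δ₁)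
  ℚ.+ δ

HasLightEdge : ∀ {n} → Graph n → ℤ → Set
HasLightEdge G ℓ =
  ∃[ u ] ∃[ v ] (u ~[ G ] v × (+ degree G u) ℤ.≤ ℓ × (+ degree G v) ℤ.≤ ℓ)

module Submission where

-- Suppose that every vertex has degree at least s and that no edge is ℓ-light.
-- Call a vertex light if its degree is at most ℓ, heavy otherwise; light
-- vertices are pairwise non-adjacent, so all their neighbours are heavy.
--
-- For s = 1, a vertex of degree at least t spans a star K_{1,t}, and otherwise
-- every vertex is light. For s ≥ 2, go through the light vertices greedily: v
-- becomes the apex of a cherry a – v – b if two of its neighbours a, b are not
-- yet joined by an earlier cherry, and is put aside otherwise. The joined pairs
-- form a graph F on the heavy vertices whose 1-subdivision (by the apexes) lies
-- in G, so F has at most δ₁·|heavy|/2 edges and each of its subgraphs has a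
-- vertex of degree at most ⌊δ₁⌋. Each vertex put aside sees s heavy vertices
-- that are pairwise joined, an s-clique of F. If t of them see the same clique,
-- they and the apexes of its edges form a K*_{s,t}. Otherwise every s-clique is
-- seen at most t − 1 times, and counting the s-cliques of the degenerate graph F
-- (its edges when s = 2) bounds |light| by c·|heavy| where (δ − s)c + δ = N₁.
-- Double counting degrees then leaves room for a total degree of at most
-- N₁·|heavy| on the heavy vertices, each of which has degree greater than N₁.

open import Defs hiding (sym)

open import Axiom.UniquenessOfIdentityProofs using (module Decidable⇒UIP)
open import Data.Bool using (if_then_else_)
import Data.Bool.Properties as Bool
open import Data.Empty using (⊥; ⊥-elim)
open import Data.Fin as Fin using (Fin)
import Data.Fin.Properties as Finₚ
open import Data.Integer as ℤ using (+_; ∣_∣)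
import Data.Integer.DivMod as ℤ
import Data.Integer.Properties as ℤₚ
open import Data.List using (List; []; _∷_; [_]; _++_; length; filter; map; lookup; allFin; take)
open import Data.List.Membership.Propositional using (_∈_; _∉_; find; lose)
open import Data.List.Membership.Propositional.Properties
  using (∈-filter⁺; ∈-filter⁻; ∈-map⁺; ∈-lookup; ∈-allFin)
open import Data.List.Properties
  using (filter-notAll; filter-some; filter-all; filter-none; map-cong; map-tabulate; tabulate-lookup;
         length-tabulate; length-take; length-map; ++-identityʳ)
open import Data.List.Relation.Binary.Permutation.Propositional.Properties using (shift)
open import Data.List.Relation.Binary.Subset.Propositional using (_⊆_)
open import Data.List.Relation.Binary.Subset.Propositional.Properties
  using (filter-⊆; ⊆-respʳ-↭; ⊆∷∧∉⇒⊆; ∈-∷⁺ʳ; ⊆[]⇒≡[])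
open import Data.List.Relation.Unary.All as All using (All; []; _∷_)
open import Data.List.Relation.Unary.All.Properties using (¬Any⇒All¬)
open import Data.List.Relation.Unary.AllPairs using ([]; _∷_)
open import Data.List.Relation.Unary.Any as Any using (Any; here; there)
import Data.List.Relation.Unary.Any.Properties as Any
open import Data.List.Relation.Unary.Unique.Propositional using (Unique)
import Data.List.Relation.Unary.Unique.Propositional.Properties as Unique
open import Data.Nat as ℕ using (ℕ; zero; suc; _+_; _*_; _∸_; _≤_; _≤?_; _≤′_; ≤′-refl; ≤′-step; z≤n; s≤s)
open import Data.Nat.Combinatorics using (_C_; nCk+nC[k+1]≡[n+1]C[k+1])
open import Data.Nat.Coprimality using (1-coprimeTo)
import Data.Nat.Coprimality as Coprime
open import Data.Nat.ListAction using (sum)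
open import Data.Nat.Properties
open import Algebra.Properties.CommutativeSemigroup +-commutativeSemigroup using (interchange; x∙yz≈y∙xz)
open import Data.Product using (∃-syntax; _×_; _,_; proj₁; proj₂)
open import Data.Rational as ℚ using (ℚ; mkℚ; floor; 0ℚ; 1ℚ; ½; _<_)
import Data.Rational.Properties as ℚₚ
open import Data.Rational.Solver using (module +-*-Solver)
open import Data.Sum as Sum using (_⊎_; inj₁; inj₂)
open import Data.Unit using (⊤; tt)
open import Function using (_∘_; _∘′_; id)
open import Function.Bundles using (mk⇔)
open import Function.Definitions using (Injective)
open import Level using (0ℓ)
open import Relation.Binary using (tri<; tri≈; tri>)
open import Relation.Binary.Definitions using (DecidableEquality)
open import Relation.Binary.PropositionalEquality using (_≡_; _≢_; refl; sym; trans; cong; cong₂; subst; subst₂)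
open import Relation.Nullary using (¬_; Dec; yes; no; does)
import Relation.Nullary.Decidable as Dec
open import Relation.Nullary.Decidable using (does-⇔; dec-false; ¬?; _×-dec_; _⊎-dec_)
open import Relation.Unary using (Pred; Decidable)
open import Relation.Unary.Properties using (_∪?_; ∁?)

count : {A : Set} {P : Pred A 0ℓ} → Decidable P → List A → ℕ
count P? xs = length (filter P? xs)

module _ {A : Set} {P Q : Pred A 0ℓ} (P? : Decidable P) (Q? : Decidable Q) where

  count-mono : ∀ xs → (∀ {x} → x ∈ xs → P x → Q x) → count P? xs ≤ count Q? xs
  count-mono []       P⇒Q = z≤n
  count-mono (x ∷ xs) P⇒Q with P? x | Q? x
  ... | yes _  | yes _  = s≤s (count-mono xs (P⇒Q ∘ there))
  ... | yes px | no ¬qx = ⊥-elim (¬qx (P⇒Q (here refl) px))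
  ... | no _   | yes _  = m≤n⇒m≤1+n (count-mono xs (P⇒Q ∘ there))
  ... | no _   | no _   = count-mono xs (P⇒Q ∘ there)

  count-∪ : ∀ xs → count (P? ∪? Q?) xs ≤ count P? xs + count Q? xs
  count-∪ []       = z≤n
  count-∪ (x ∷ xs) with ih ← count-∪ xs | P? x | Q? x
  ... | yes _ | yes _ = s≤s (≤-trans ih (+-monoʳ-≤ (count P? xs) (n≤1+n _)))
  ... | yes _ | no _  = s≤s ih
  ... | no _  | yes _ = ≤-trans (s≤s ih) (≤-reflexive (sym (+-suc _ _)))
  ... | no _  | no _  = ih

  count-∪-disjoint : ∀ xs → (∀ {x} → P x → Q x → ⊥) → count P? xs + count Q? xs ≤ count (P? ∪? Q?) xs
  count-∪-disjoint []       _        = z≤n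
  count-∪-disjoint (x ∷ xs) disjoint with ih ← count-∪-disjoint xs disjoint | P? x | Q? x
  ... | yes px | yes qx = ⊥-elim (disjoint px qx)
  ... | yes _  | no _   = s≤s ih
  ... | no _   | yes _  = ≤-trans (≤-reflexive (+-suc _ _)) (s≤s ih)
  ... | no _   | no _   = ih

module _ {A : Set} {P : Pred A 0ℓ} (P? : Decidable P) where

  sum-map-if-does : ∀ xs → sum (map (λ x → if does (P? x) then 1 else 0) xs) ≡ count P? xs
  sum-map-if-does []       = refl
  sum-map-if-does (x ∷ xs) with P? x
  ... | yes _ = cong suc (sum-map-if-does xs)
  ... | no _  = sum-map-if-does xs

  count>0 : ∀ {x xs} → x ∈ xs → P x → 0 ℕ.< count P? xs
  count>0 x∈xs px = filter-some P? (lose x∈xs px)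

  count+count-∁≡length : ∀ xs → count P? xs + count (∁? P?) xs ≡ length xs
  count+count-∁≡length []       = refl
  count+count-∁≡length (x ∷ xs) with P? x
  ... | yes _ = cong suc (count+count-∁≡length xs)
  ... | no _  = trans (+-suc _ _) (cong suc (count+count-∁≡length xs))

  sum-map-filter+filter-∁ : ∀ (f : A → ℕ) xs →
    sum (map f (filter P? xs)) + sum (map f (filter (∁? P?) xs)) ≡ sum (map f xs)
  sum-map-filter+filter-∁ f []       = refl
  sum-map-filter+filter-∁ f (x ∷ xs) with ih ← sum-map-filter+filter-∁ f xs | P? x
  ... | yes _ = trans (+-assoc (f x) _ _) (cong (_+_ (f x)) ih)
  ... | no _  = trans (x∙yz≈y∙xz (sum (map f (filter P? xs))) (f x) _) (cong (_+_ (f x)) ih)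

module _ {A : Set} where

  sum-map-+ : ∀ (f g : A → ℕ) xs → sum (map (λ x → f x + g x) xs) ≡ sum (map f xs) + sum (map g xs)
  sum-map-+ f g []       = refl
  sum-map-+ f g (x ∷ xs) =
    trans (cong (_+_ (f x + g x)) (sum-map-+ f g xs)) (interchange (f x) (g x) _ _)

  sum-map-mono : ∀ {f g : A → ℕ} xs → (∀ x → f x ≤ g x) → sum (map f xs) ≤ sum (map g xs)
  sum-map-mono []       f≤g = z≤n
  sum-map-mono (x ∷ xs) f≤g = +-mono-≤ (f≤g x) (sum-map-mono xs f≤g)

  sum-map-≥ : ∀ {f : A → ℕ} {k} xs → (∀ {x} → x ∈ xs → k ≤ f x) → k * length xs ≤ sum (map f xs)
  sum-map-≥ {k = k} []       k≤f = ≤-reflexive (*-zeroʳ k)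
  sum-map-≥ {k = k} (x ∷ xs) k≤f =
    ≤-trans (≤-reflexive (*-suc k (length xs))) (+-mono-≤ (k≤f (here refl)) (sum-map-≥ xs (k≤f ∘ there)))

  sum-map-≤ : ∀ {f : A → ℕ} {k} xs → (∀ {x} → x ∈ xs → f x ≤ k) → sum (map f xs) ≤ k * length xs
  sum-map-≤ {k = k} []       f≤k = z≤n
  sum-map-≤ {k = k} (x ∷ xs) f≤k =
    ≤-trans (+-mono-≤ (f≤k (here refl)) (sum-map-≤ xs (f≤k ∘ there))) (≤-reflexive (sym (*-suc k (length xs))))

  ∈⇒≤sum-map : ∀ (f : A → ℕ) {x xs} → x ∈ xs → f x ≤ sum (map f xs)
  ∈⇒≤sum-map f {xs = y ∷ xs} (here refl) = m≤m+n (f y) _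
  ∈⇒≤sum-map f {xs = y ∷ xs} (there x∈xs) = ≤-trans (∈⇒≤sum-map f x∈xs) (m≤n+m _ (f y))

  ∈∈⇒+≤sum-map : ∀ (f : A → ℕ) {x y xs} → x ≢ y → x ∈ xs → y ∈ xs → f x + f y ≤ sum (map f xs)
  ∈∈⇒+≤sum-map f x≢y (here refl) (here refl) = ⊥-elim (x≢y refl)
  ∈∈⇒+≤sum-map f {xs = z ∷ xs} x≢y (here refl) (there y∈xs) = +-monoʳ-≤ (f z) (∈⇒≤sum-map f y∈xs)
  ∈∈⇒+≤sum-map f {x} {xs = z ∷ xs} x≢y (there x∈xs) (here refl) =
    ≤-trans (≤-reflexive (+-comm (f x) (f z))) (+-monoʳ-≤ (f z) (∈⇒≤sum-map f x∈xs))
  ∈∈⇒+≤sum-map f {xs = z ∷ xs} x≢y (there x∈xs) (there y∈xs) =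
    ≤-trans (∈∈⇒+≤sum-map f x≢y x∈xs y∈xs) (m≤n+m _ (f z))

  map-lookup-allFin : ∀ {B : Set} (f : A → B) xs → map (f ∘ lookup xs) (allFin (length xs)) ≡ map f xs
  map-lookup-allFin f xs = trans (map-tabulate (λ i → i) (f ∘ lookup xs))
    (trans (sym (map-tabulate (lookup xs) f)) (cong (map f) (tabulate-lookup xs)))

  lookup-injective : ∀ {xs : List A} → Unique xs → ∀ {i j} → lookup xs i ≡ lookup xs j → i ≡ j
  lookup-injective {_ ∷ _} _ {Fin.zero}  {Fin.zero}  _ = refl
  lookup-injective {_ ∷ _} (x∉xs ∷ _) {Fin.zero}  {Fin.suc j} x≡ = ⊥-elim (All.lookup x∉xs (∈-lookup j) x≡)
  lookup-injective {_ ∷ _} (x∉xs ∷ _) {Fin.suc i} {Fin.zero}  ≡x = ⊥-elim (All.lookup x∉xs (∈-lookup i) (sym ≡x))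
  lookup-injective {_ ∷ _} (_ ∷ !xs)  {Fin.suc i} {Fin.suc j} eq = cong Fin.suc (lookup-injective !xs eq)

  injective-on-map : ∀ {B : Set} (f : A → B) {xs} → Unique (map f xs) →
    ∀ {x y} → x ∈ xs → y ∈ xs → f x ≡ f y → x ≡ y
  injective-on-map f _ (here refl) (here refl) _ = refl
  injective-on-map f (fx∉ ∷ _) (here refl) (there y∈xs) fx≡fy = ⊥-elim (All.lookup fx∉ (∈-map⁺ f y∈xs) fx≡fy)
  injective-on-map f (fy∉ ∷ _) (there x∈xs) (here refl) fx≡fy = ⊥-elim (All.lookup fy∉ (∈-map⁺ f x∈xs) (sym fx≡fy))
  injective-on-map f (_ ∷ !fxs) (there x∈xs) (there y∈xs) fx≡fy = injective-on-map f !fxs x∈xs y∈xs fx≡fy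

module _ {A : Set} (_≟_ : DecidableEquality A) where

  remove : A → List A → List A
  remove x = filter (λ y → ¬? (x ≟ y))

  length-remove< : ∀ {x} ys → x ∈ ys → length (remove x ys) ℕ.< length ys
  length-remove< ys x∈ys = filter-notAll _ ys (Any.map (λ x≡y x≢y → x≢y x≡y) x∈ys)

  remove-⊆ : ∀ x ys → remove x ys ⊆ ys
  remove-⊆ x ys = filter-⊆ _ ys

  remove-unique : ∀ x {ys} → Unique ys → Unique (remove x ys)
  remove-unique x = Unique.filter⁺ _

  ∈-remove⁺ : ∀ {x y ys} → y ∈ ys → x ≢ y → y ∈ remove x ys
  ∈-remove⁺ = ∈-filter⁺ _

  unique-⊆⇒length≤ : ∀ {xs ys : List A} → Unique xs → xs ⊆ ys → length xs ≤ length ys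
  unique-⊆⇒length≤ {[]}     _            _     = z≤n
  unique-⊆⇒length≤ {x ∷ xs} {ys} (x∉xs ∷ !xs) x∷xs⊆ys =
    ≤-trans (s≤s (unique-⊆⇒length≤ !xs xs⊆ys−x)) (length-remove< ys (x∷xs⊆ys (here refl)))
    where
    xs⊆ys−x : xs ⊆ remove x ys
    xs⊆ys−x y∈xs = ∈-remove⁺ (x∷xs⊆ys (there y∈xs)) (All.lookup x∉xs y∈xs)

module _ {A : Set} where

  length≤sum-map-count : ∀ {B : Set} {_∼_ : B → A → Set} (_∼?_ : ∀ X x → Dec (X ∼ x)) Xs xs →
    (∀ {x} → x ∈ xs → Any (_∼ x) Xs) → length xs ≤ sum (map (λ X → count (X ∼?_) xs) Xs)
  length≤sum-map-count _∼?_ Xs []       _       = z≤n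
  length≤sum-map-count _∼?_ Xs (x ∷ xs) covered = begin
    suc (length xs)                                           ≤⟨ +-mono-≤ x-covered xs-covered ⟩
    count (_∼? x) Xs + sum (map (λ X → count (X ∼?_) xs) Xs)  ≡⟨ sym (sum-map-count-∷ Xs) ⟩
    sum (map (λ X → count (X ∼?_) (x ∷ xs)) Xs)               ∎
    where
    open ≤-Reasoning
    x-covered : 1 ≤ count (_∼? x) Xs
    x-covered = filter-some (_∼? x) (covered (here refl))
    xs-covered : length xs ≤ sum (map (λ X → count (X ∼?_) xs) Xs)
    xs-covered = length≤sum-map-count _∼?_ Xs xs (covered ∘ there)
    sum-map-count-∷ : ∀ Ys → sum (map (λ X → count (X ∼?_) (x ∷ xs)) Ys)
                             ≡ count (_∼? x) Ys + sum (map (λ X → count (X ∼?_) xs) Ys)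
    sum-map-count-∷ [] = refl
    sum-map-count-∷ (Y ∷ Ys) with ih ← sum-map-count-∷ Ys | Y ∼? x
    ... | yes _ = cong suc (trans (cong (_+_ (count (Y ∼?_) xs)) ih)
                    (x∙yz≈y∙xz (count (Y ∼?_) xs) (count (_∼? x) Ys) (sum (map (λ X → count (X ∼?_) xs) Ys))))
    ... | no _  = trans (cong (_+_ (count (Y ∼?_) xs)) ih)
                    (x∙yz≈y∙xz (count (Y ∼?_) xs) (count (_∼? x) Ys) (sum (map (λ X → count (X ∼?_) xs) Ys)))

  pick : (xs : List A) {k : ℕ} → k ≤ length xs → Fin k → A
  pick xs k≤ i = lookup xs (Fin.inject≤ i k≤)

  pick-∈ : ∀ xs {k} (k≤ : k ≤ length xs) i → pick xs k≤ i ∈ xs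
  pick-∈ xs k≤ i = ∈-lookup (Fin.inject≤ i k≤)

  pick-injective : ∀ {xs} {k} (k≤ : k ≤ length xs) → Unique xs → Injective _≡_ _≡_ (pick xs k≤)
  pick-injective k≤ !xs eq = Finₚ.inject≤-injective k≤ k≤ _ _ (lookup-injective !xs eq)

swap-⊆ : ∀ {A : Set} {x y : A} → x ∷ y ∷ [] ⊆ y ∷ x ∷ []
swap-⊆ (here refl)         = there (here refl)
swap-⊆ (there (here refl)) = here refl

take-⊆ : ∀ {A : Set} k (xs : List A) → take k xs ⊆ xs
take-⊆ (suc k) (x ∷ xs) (here refl) = here refl
take-⊆ (suc k) (x ∷ xs) (there x∈)  = there (take-⊆ k xs x∈)

ℕ→ℚ≡mkℚ : ∀ k → ℕ→ℚ k ≡ mkℚ (+ k) 0 (Coprime.sym (1-coprimeTo k))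
ℕ→ℚ≡mkℚ k = ℚₚ.normalize-coprime (Coprime.sym (1-coprimeTo k))

ℕ→ℚ-+ : ∀ a b → ℕ→ℚ (a + b) ≡ ℕ→ℚ a ℚ.+ ℕ→ℚ b
ℕ→ℚ-+ a b rewrite ℕ→ℚ≡mkℚ a | ℕ→ℚ≡mkℚ b =
  ℚₚ./-cong {p₁ = + (a + b)} {p₂ = + a ℤ.* + 1 ℤ.+ + b ℤ.* + 1}
    (sym (cong₂ ℤ._+_ (ℤₚ.*-identityʳ (+ a)) (ℤₚ.*-identityʳ (+ b)))) refl

ℕ→ℚ-* : ∀ a b → ℕ→ℚ (a * b) ≡ ℕ→ℚ a ℚ.* ℕ→ℚ b
ℕ→ℚ-* a b rewrite ℕ→ℚ≡mkℚ a | ℕ→ℚ≡mkℚ b =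
  ℚₚ./-cong {p₁ = + (a * b)} {p₂ = + a ℤ.* + b} (ℤₚ.pos-* a b) refl

ℕ→ℚ-mono-≤ : ∀ {a b} → a ≤ b → ℕ→ℚ a ℚ.≤ ℕ→ℚ b
ℕ→ℚ-mono-≤ {a} {b} a≤b rewrite ℕ→ℚ≡mkℚ a | ℕ→ℚ≡mkℚ b =
  ℚ.*≤* (ℤₚ.*-monoʳ-≤-nonNeg (+ 1) (ℤ.+≤+ a≤b))

ℕ→ℚ-mono-< : ∀ {a b} → a ℕ.< b → ℕ→ℚ a ℚ.< ℕ→ℚ b
ℕ→ℚ-mono-< {a} {b} a<b rewrite ℕ→ℚ≡mkℚ a | ℕ→ℚ≡mkℚ b =
  ℚ.*<* (subst₂ ℤ._<_ (sym (ℤₚ.*-identityʳ (+ a))) (sym (ℤₚ.*-identityʳ (+ b))) (ℤ.+<+ a<b))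

ℕ→ℚ-pred : ∀ t → 1 ≤ t → ℕ→ℚ (t ∸ 1) ≡ ℕ→ℚ t ℚ.- 1ℚ
ℕ→ℚ-pred (suc t) _ = trans (x≡[1+x]-1 (ℕ→ℚ t)) (cong (ℚ._- 1ℚ) (sym (ℕ→ℚ-+ 1 t)))
  where
  open +-*-Solver
  x≡[1+x]-1 : ∀ x → x ≡ (1ℚ ℚ.+ x) ℚ.- 1ℚ
  x≡[1+x]-1 = solve 1 (λ x → x := (con 1ℚ :+ x) :- con 1ℚ) refl

≤⇒≤floor : ∀ k q → ℕ→ℚ k ℚ.≤ q → + k ℤ.≤ floor q
≤⇒≤floor k q@(mkℚ p d-1 _) k≤q rewrite ℕ→ℚ≡mkℚ k with k≤q
... | ℚ.*≤* k*d≤p*1 =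
  subst (+ k ℤ.≤_) (ℤₚ.pred-suc (floor q)) (ℤₚ.i<j⇒i≤pred[j] {+ k} k<1+floor)
  where
  d : ℕ
  d = suc d-1
  k*d<[1+p/d]*d : + k ℤ.* + d ℤ.< ℤ.suc (p ℤ./ℕ d) ℤ.* + d
  k*d<[1+p/d]*d = ℤₚ.≤-<-trans (subst (+ k ℤ.* + d ℤ.≤_) (ℤₚ.*-identityʳ p) k*d≤p*1) (ℤ.n<s[n/ℕd]*d p d)
  k<1+floor : + k ℤ.< ℤ.suc (floor q)
  k<1+floor = subst (λ z → + k ℤ.< ℤ.suc z) (sym (ℤ.div-pos-is-/ℕ p d))
    (ℤₚ.*-cancelʳ-<-nonNeg (+ d) k*d<[1+p/d]*d)

floor<⇒< : ∀ k q → floor q ℤ.< + k → q ℚ.< ℕ→ℚ k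
floor<⇒< k q floor<k with q ℚₚ.<? ℕ→ℚ k
... | yes q<k = q<k
... | no  q≮k = ⊥-elim (ℤₚ.<⇒≱ floor<k (≤⇒≤floor k q (ℚₚ.≮⇒≥ q≮k)))

<1+∣floor∣ : ∀ q → q ℚ.< ℕ→ℚ (suc ∣ floor q ∣)
<1+∣floor∣ q = floor<⇒< (suc ∣ floor q ∣) q (ℤₚ.≤-<-trans (i≤∣i∣ (floor q)) (ℤ.+<+ (n<1+n _)))
  where
  i≤∣i∣ : ∀ i → i ℤ.≤ + ∣ i ∣
  i≤∣i∣ (+ _)      = ℤₚ.≤-refl
  i≤∣i∣ ℤ.-[1+ _ ] = ℤ.-≤+

sum-map-> : ∀ {A : Set} (f : A → ℕ) (q : ℚ) {x} xs → x ∈ xs → (∀ {y} → y ∈ xs → q ℚ.< ℕ→ℚ (f y)) →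
  q ℚ.* ℕ→ℚ (length xs) ℚ.< ℕ→ℚ (sum (map f xs))
sum-map-> f q (y ∷ []) _ q<f =
  subst₂ ℚ._<_ (sym (ℚₚ.*-identityʳ q)) (cong ℕ→ℚ (sym (+-identityʳ (f y)))) (q<f (here refl))
sum-map-> f q (y ∷ ys@(_ ∷ _)) _ q<f =
  subst₂ ℚ._<_ (sym q*[1+l]≡q+q*l) (sym (ℕ→ℚ-+ (f y) _))
    (ℚₚ.+-mono-< (q<f (here refl)) (sum-map-> f q ys (here refl) (q<f ∘ there)))
  where
  q*[1+l]≡q+q*l : q ℚ.* ℕ→ℚ (suc (length ys)) ≡ q ℚ.+ q ℚ.* ℕ→ℚ (length ys)
  q*[1+l]≡q+q*l = trans (cong (q ℚ.*_) (ℕ→ℚ-+ 1 (length ys)))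
    (trans (ℚₚ.*-distribˡ-+ q 1ℚ _) (cong (ℚ._+ q ℚ.* ℕ→ℚ (length ys)) (ℚₚ.*-identityʳ q)))

split-degree-bound : ∀ (δ s c a b σS σB : ℚ) →
  σS ℚ.+ σB ℚ.≤ δ ℚ.* (a ℚ.+ b) → s ℚ.* a ℚ.≤ σS → s ℚ.≤ δ → a ℚ.≤ c ℚ.* b →
  σB ℚ.≤ ((δ ℚ.- s) ℚ.* c ℚ.+ δ) ℚ.* b
split-degree-bound δ s c a b σS σB σ≤δ[a+b] sa≤σS s≤δ a≤cb = begin
  σB                                      ≡⟨ x≡[y+x]-y (s ℚ.* a) σB ⟩
  (s ℚ.* a ℚ.+ σB) ℚ.- s ℚ.* a            ≤⟨ ℚₚ.+-monoˡ-≤ (ℚ.- (s ℚ.* a)) sa+σB≤δ[a+b] ⟩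
  δ ℚ.* (a ℚ.+ b) ℚ.- s ℚ.* a             ≡⟨ regroup δ a b s ⟩
  (δ ℚ.- s) ℚ.* a ℚ.+ δ ℚ.* b             ≤⟨ ℚₚ.+-monoˡ-≤ (δ ℚ.* b) (ℚₚ.*-monoˡ-≤-nonNeg (δ ℚ.- s) a≤cb) ⟩
  (δ ℚ.- s) ℚ.* (c ℚ.* b) ℚ.+ δ ℚ.* b     ≡⟨ factor δ s c b ⟩
  ((δ ℚ.- s) ℚ.* c ℚ.+ δ) ℚ.* b           ∎
  where
  open ℚₚ.≤-Reasoning
  open +-*-Solver
  x≡[y+x]-y : ∀ y x → x ≡ (y ℚ.+ x) ℚ.- y
  x≡[y+x]-y = solve 2 (λ y x → x := (y :+ x) :- y) refl
  regroup : ∀ δ a b s → δ ℚ.* (a ℚ.+ b) ℚ.- s ℚ.* a ≡ (δ ℚ.- s) ℚ.* a ℚ.+ δ ℚ.* b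
  regroup = solve 4 (λ δ a b s → δ :* (a :+ b) :- s :* a := (δ :- s) :* a :+ δ :* b) refl
  factor : ∀ δ s c b → (δ ℚ.- s) ℚ.* (c ℚ.* b) ℚ.+ δ ℚ.* b ≡ ((δ ℚ.- s) ℚ.* c ℚ.+ δ) ℚ.* b
  factor = solve 4 (λ δ s c b → (δ :- s) :* (c :* b) :+ δ :* b := ((δ :- s) :* c :+ δ) :* b) refl
  sa+σB≤δ[a+b] : s ℚ.* a ℚ.+ σB ℚ.≤ δ ℚ.* (a ℚ.+ b)
  sa+σB≤δ[a+b] = ℚₚ.≤-trans (ℚₚ.+-monoˡ-≤ σB sa≤σS) σ≤δ[a+b]
  instance
    δ-s≥0 : ℚ.NonNegative (δ ℚ.- s)
    δ-s≥0 = ℚ.nonNegative (subst (ℚ._≤ δ ℚ.- s) (ℚₚ.+-inverseʳ s) (ℚₚ.+-monoˡ-≤ (ℚ.- s) s≤δ))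

≤-half : ∀ T {x} → ℕ→ℚ (2 * T) ℚ.≤ x → ℕ→ℚ T ℚ.≤ ½ ℚ.* x
≤-half T {x} 2T≤x = begin
  ℕ→ℚ T                          ≡⟨ sym (ℚₚ.*-identityˡ (ℕ→ℚ T)) ⟩
  (½ ℚ.* ℕ→ℚ 2) ℚ.* ℕ→ℚ T        ≡⟨ ℚₚ.*-assoc ½ (ℕ→ℚ 2) (ℕ→ℚ T) ⟩
  ½ ℚ.* (ℕ→ℚ 2 ℚ.* ℕ→ℚ T)        ≡⟨ cong (½ ℚ.*_) (sym (ℕ→ℚ-* 2 T)) ⟩
  ½ ℚ.* ℕ→ℚ (2 * T)              ≤⟨ ℚₚ.*-monoˡ-≤-nonNeg ½ 2T≤x ⟩
  ½ ℚ.* x                        ∎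
  where open ℚₚ.≤-Reasoning

clique-count-bound : ∀ δ₁ M T R b → ℕ→ℚ (2 * T) ℚ.≤ δ₁ ℚ.* ℕ→ℚ b → R ≤ M * b →
  ℕ→ℚ (T + R) ℚ.≤ (ℕ→ℚ M ℚ.+ ½ ℚ.* δ₁) ℚ.* ℕ→ℚ b
clique-count-bound δ₁ M T R b 2T≤δ₁b R≤Mb = begin
  ℕ→ℚ (T + R)                                   ≡⟨ ℕ→ℚ-+ T R ⟩
  ℕ→ℚ T ℚ.+ ℕ→ℚ R                               ≤⟨ ℚₚ.+-mono-≤ (≤-half T 2T≤δ₁b) R≤Mb′ ⟩
  ½ ℚ.* (δ₁ ℚ.* ℕ→ℚ b) ℚ.+ ℕ→ℚ M ℚ.* ℕ→ℚ b      ≡⟨ regroup ½ δ₁ (ℕ→ℚ M) (ℕ→ℚ b) ⟩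
  (ℕ→ℚ M ℚ.+ ½ ℚ.* δ₁) ℚ.* ℕ→ℚ b                ∎
  where
  open ℚₚ.≤-Reasoning
  open +-*-Solver
  R≤Mb′ : ℕ→ℚ R ℚ.≤ ℕ→ℚ M ℚ.* ℕ→ℚ b
  R≤Mb′ = ℚₚ.≤-trans (ℕ→ℚ-mono-≤ R≤Mb) (ℚₚ.≤-reflexive (ℕ→ℚ-* M b))
  regroup : ∀ h d m b → h ℚ.* (d ℚ.* b) ℚ.+ m ℚ.* b ≡ (m ℚ.+ h ℚ.* d) ℚ.* b
  regroup = solve 4 (λ h d m b → h :* (d :* b) :+ m :* b := (m :+ h :* d) :* b) refl

pair-count-bound : ∀ δ₁ t T R b → 1 ≤ t → ℕ→ℚ (2 * T) ℚ.≤ δ₁ ℚ.* ℕ→ℚ b → R ≤ (t ∸ 1) * T →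
  ℕ→ℚ (T + R) ℚ.≤ (½ ℚ.* δ₁ ℚ.* ℕ→ℚ t) ℚ.* ℕ→ℚ b
pair-count-bound δ₁ (suc t) T R b _ 2T≤δ₁b R≤tT = begin
  ℕ→ℚ (T + R)                                   ≤⟨ ℕ→ℚ-mono-≤ (+-monoʳ-≤ T R≤tT) ⟩
  ℕ→ℚ (suc t * T)                               ≡⟨ ℕ→ℚ-* (suc t) T ⟩
  ℕ→ℚ (suc t) ℚ.* ℕ→ℚ T                         ≤⟨ ℚₚ.*-monoˡ-≤-nonNeg (ℕ→ℚ (suc t)) (≤-half T 2T≤δ₁b) ⟩
  ℕ→ℚ (suc t) ℚ.* (½ ℚ.* (δ₁ ℚ.* ℕ→ℚ b))        ≡⟨ regroup ½ δ₁ (ℕ→ℚ (suc t)) (ℕ→ℚ b) ⟩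
  (½ ℚ.* δ₁ ℚ.* ℕ→ℚ (suc t)) ℚ.* ℕ→ℚ b          ∎
  where
  open ℚₚ.≤-Reasoning
  open +-*-Solver
  regroup : ∀ h d t b → t ℚ.* (h ℚ.* (d ℚ.* b)) ≡ (h ℚ.* d ℚ.* t) ℚ.* b
  regroup = solve 4 (λ h d t b → t :* (h :* (d :* b)) := (h :* d :* t) :* b) refl
  instance
    1+t≥0 : ℚ.NonNegative (ℕ→ℚ (suc t))
    1+t≥0 = ℚ.nonNegative (ℕ→ℚ-mono-≤ {0} {suc t} z≤n)

-- Graphs and copies of K*_{s,t}

module _ {n : ℕ} (G : Graph n) where

  adjacent? : ∀ u v → Dec (u ~[ G ] v)
  adjacent? u v = Dec.map Bool.T-≡ (Dec.T? (adj G u v))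

  ~-sym : ∀ {u v} → u ~[ G ] v → v ~[ G ] u
  ~-sym {u} {v} = trans (Graph.sym G v u)

  ~-irrefl : ∀ {u} → ¬ u ~[ G ] u
  ~-irrefl {u} u~u with () ← trans (sym (Graph.irrefl G u)) u~u

  neighbours : Fin n → List (Fin n)
  neighbours v = filter (adjacent? v) (allFin n)

  length-neighbours : ∀ v → length (neighbours v) ≡ degree G v
  length-neighbours v = sym (sum-map-if-does (adjacent? v) (allFin n))

  neighbours-unique : ∀ v → Unique (neighbours v)
  neighbours-unique v = Unique.filter⁺ (adjacent? v) (Unique.allFin⁺ n)

  ∈-neighbours⁻ : ∀ {u v} → u ∈ neighbours v → v ~[ G ] u
  ∈-neighbours⁻ {v = v} = proj₂ ∘ ∈-filter⁻ (adjacent? v) {xs = allFin n}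

  neighbour : ∀ v → 1 ≤ degree G v → ∃[ u ] v ~[ G ] u
  neighbour v 1≤deg = _ , ∈-neighbours⁻ (pick-∈ (neighbours v) 1≤length Fin.zero)
    where
    1≤length : 1 ≤ length (neighbours v)
    1≤length = subst (1 ≤_) (sym (length-neighbours v)) 1≤deg

minDegree≤avgDegree : ∀ {m} (H : Graph m) {δ k} → 0 ℕ.< m → AvgDegAtMost H δ →
  (∀ v → k ≤ degree H v) → ℕ→ℚ k ℚ.≤ δ
minDegree≤avgDegree {m} H {δ} {k} m>0 avg≤δ k≤deg = ℚₚ.*-cancelʳ-≤-pos (ℕ→ℚ m) (begin
  ℕ→ℚ k ℚ.* ℕ→ℚ m     ≡⟨ sym (ℕ→ℚ-* k m) ⟩
  ℕ→ℚ (k * m)         ≤⟨ ℕ→ℚ-mono-≤ k*m≤degSum ⟩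
  ℕ→ℚ (degSum H)      ≤⟨ avg≤δ ⟩
  δ ℚ.* ℕ→ℚ m         ∎)
  where
  open ℚₚ.≤-Reasoning
  instance
    m-positive : ℚ.Positive (ℕ→ℚ m)
    m-positive = ℚ.positive (ℕ→ℚ-mono-< m>0)
  k*m≤degSum : k * m ≤ degSum H
  k*m≤degSum = subst (λ l → k * l ≤ degSum H) (length-tabulate id) (sum-map-≥ (allFin m) (λ {v} _ → k≤deg v))

lowDegreeVertex : ∀ {m} (H : Graph m) {δ} → 0 ℕ.< m → AvgDegAtMost H δ → ∃[ i ] degree H i ≤ ∣ floor δ ∣
lowDegreeVertex H {δ} 0<m avg≤δ with Finₚ.any? (λ i → degree H i ≤? ∣ floor δ ∣)
... | yes low = low
... | no ¬low = ⊥-elim (ℚₚ.<-irrefl refl (ℚₚ.<-≤-trans (<1+∣floor∣ δ)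
                  (minDegree≤avgDegree H 0<m avg≤δ (λ i → ≰⇒> (¬low ∘ (i ,_))))))

⊆G-refl : ∀ {n} (G : Graph n) → G ⊆G G
⊆G-refl G = (λ v → v) , (λ eq → eq) , (λ _ _ e → e)

hasLightEdge? : ∀ {n} (G : Graph n) ℓ → Dec (HasLightEdge G ℓ)
hasLightEdge? G ℓ = Finₚ.any? λ u → Finₚ.any? λ v →
  adjacent? G u v ×-dec (+ degree G u ℤ.≤? ℓ) ×-dec (+ degree G v ℤ.≤? ℓ)

record KStarImage {n : ℕ} (G : Graph n) (s t : ℕ) : Set where
  field
    a : Fin s → Fin n
    b : Fin t → Fin n
    c : ∀ i j → i Fin.< j → Fin n
    a-injective : Injective _≡_ _≡_ a
    b-injective : Injective _≡_ _≡_ b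
    c-injective : ∀ i j p i′ j′ p′ → c i j p ≡ c i′ j′ p′ → i ≡ i′ × j ≡ j′
    a≢b : ∀ i j → a i ≢ b j
    a≢c : ∀ i j k p → a i ≢ c j k p
    b≢c : ∀ i j k p → b i ≢ c j k p
    a~b : ∀ i j → a i ~[ G ] b j
    c~a₁ : ∀ i j p → c i j p ~[ G ] a i
    c~a₂ : ∀ i j p → c i j p ~[ G ] a j

module _ {n : ℕ} (G : Graph n) {s t : ℕ} (image : KStarImage G s t) where
  open KStarImage image

  private
    f : KStarV s t → Fin n
    f (A i)      = a i
    f (B j)      = b j
    f (Cv i j p) = c i j p

    f-injective : Injective _≡_ _≡_ f
    f-injective {A i}      {A j}        eq = cong A (a-injective eq)
    f-injective {A i}      {B j}        eq = ⊥-elim (a≢b i j eq)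
    f-injective {A i}      {Cv j k p}   eq = ⊥-elim (a≢c i j k p eq)
    f-injective {B i}      {A j}        eq = ⊥-elim (a≢b j i (sym eq))
    f-injective {B i}      {B j}        eq = cong B (b-injective eq)
    f-injective {B i}      {Cv j k p}   eq = ⊥-elim (b≢c i j k p eq)
    f-injective {Cv j k p} {A i}        eq = ⊥-elim (a≢c i j k p (sym eq))
    f-injective {Cv j k p} {B i}        eq = ⊥-elim (b≢c i j k p (sym eq))
    f-injective {Cv i j p} {Cv i′ j′ p′} eq with c-injective i j p i′ j′ p′ eq
    ... | refl , refl with Finₚ.<-irrelevant p p′
    ...   | refl = refl

    f-edge : ∀ u v → KStarE s t u v → f u ~[ G ] f v
    f-edge _ _ (ab i j)    = a~b i j
    f-edge _ _ (ba i j)    = ~-sym G (a~b i j)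
    f-edge _ _ (ci₁ i j p) = c~a₁ i j p
    f-edge _ _ (ci₂ i j p) = ~-sym G (c~a₁ i j p)
    f-edge _ _ (cj₁ i j p) = c~a₂ i j p
    f-edge _ _ (cj₂ i j p) = ~-sym G (c~a₂ i j p)

  KStarImage⇒ContainsKStar : ContainsKStar G s t
  KStarImage⇒ContainsKStar = f , f-injective , f-edge

star⇒ContainsKStar : ∀ {n} (G : Graph n) {t} v → t ≤ degree G v → ContainsKStar G 1 t
star⇒ContainsKStar {n} G {t} v t≤deg = KStarImage⇒ContainsKStar G (record
  { a = λ _ → v
  ; b = leaf
  ; c = λ { Fin.zero Fin.zero () }
  ; a-injective = λ { {Fin.zero} {Fin.zero} _ → refl }
  ; b-injective = pick-injective t≤ (neighbours-unique G v)
  ; c-injective = λ { Fin.zero Fin.zero () }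
  ; a≢b = λ _ j v≡leaf → ~-irrefl G (subst (v ~[ G ]_) (sym v≡leaf) (v~leaf j))
  ; a≢c = λ { _ Fin.zero Fin.zero () }
  ; b≢c = λ { _ Fin.zero Fin.zero () }
  ; a~b = λ _ → v~leaf
  ; c~a₁ = λ { Fin.zero Fin.zero () }
  ; c~a₂ = λ { Fin.zero Fin.zero () }
  })
  where
  t≤ : t ≤ length (neighbours G v)
  t≤ = subst (t ≤_) (sym (length-neighbours G v)) t≤deg
  leaf : Fin t → Fin n
  leaf = pick (neighbours G v) t≤
  v~leaf : ∀ j → v ~[ G ] leaf j
  v~leaf j = ∈-neighbours⁻ G (pick-∈ (neighbours G v) t≤ j)

-- Cherries and the graph of the pairs they join

record Cherry (n : ℕ) : Set where
  constructor cherry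
  field
    end₁ end₂ apex : Fin n
open Cherry public

module _ {n : ℕ} where

  Ends : Cherry n → Fin n → Fin n → Set
  Ends τ a b = (a ≡ end₁ τ × b ≡ end₂ τ) ⊎ (a ≡ end₂ τ × b ≡ end₁ τ)

  ends? : ∀ τ a b → Dec (Ends τ a b)
  ends? τ a b = ((a Fin.≟ end₁ τ) ×-dec (b Fin.≟ end₂ τ)) ⊎-dec ((a Fin.≟ end₂ τ) ×-dec (b Fin.≟ end₁ τ))

  Ends-sym : ∀ {τ a b} → Ends τ a b → Ends τ b a
  Ends-sym (inj₁ (a≡ , b≡)) = inj₂ (b≡ , a≡)
  Ends-sym (inj₂ (a≡ , b≡)) = inj₁ (b≡ , a≡)

  Joins : List (Cherry n) → Fin n → Fin n → Set
  Joins T a b = Any (λ τ → Ends τ a b) T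

  joins? : ∀ T a b → Dec (Joins T a b)
  joins? T a b = Any.any? (λ τ → ends? τ a b) T

  Joins-sym : ∀ {T a b} → Joins T a b → Joins T b a
  Joins-sym = Any.map (λ {τ} → Ends-sym {τ})

  apexes : List (Cherry n) → List (Fin n)
  apexes = map apex

  NewPairs : List (Cherry n) → Set
  NewPairs []      = ⊤
  NewPairs (τ ∷ T) = ¬ Joins T (end₁ τ) (end₂ τ) × NewPairs T

  endpoints : Cherry n → List (Fin n)
  endpoints τ = end₁ τ ∷ end₂ τ ∷ []

  Ends⇒endpoints≈ : ∀ {τ p q} → Ends τ p q → endpoints τ ⊆ p ∷ q ∷ [] × p ∷ q ∷ [] ⊆ endpoints τ
  Ends⇒endpoints≈ (inj₁ (refl , refl)) = (λ x∈ → x∈) , (λ x∈ → x∈)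
  Ends⇒endpoints≈ (inj₂ (refl , refl)) = swap-⊆ , swap-⊆

  joined-pair⇒endpoints : ∀ T {X : List (Fin n)} → length X ≡ 2 → Unique X →
    (∀ {a b} → a ∈ X → b ∈ X → a ≢ b → Joins T a b) → Any (λ τ → endpoints τ ⊆ X × X ⊆ endpoints τ) T
  joined-pair⇒endpoints T {p ∷ q ∷ []} refl ((p≢q ∷ []) ∷ _) joined
    with τ , τ∈T , ends ← find (joined (here refl) (there (here refl)) p≢q)
    = lose τ∈T (Ends⇒endpoints≈ {τ} ends)

IsCherry : ∀ {n} → Graph n → Cherry n → Set
IsCherry G τ = end₁ τ Fin.< end₂ τ × end₁ τ ~[ G ] apex τ × end₂ τ ~[ G ] apex τ

module CherryGraph {n : ℕ} (G : Graph n) (T : List (Cherry n)) (valid : All (IsCherry G) T) where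

  ¬Joins-self : ∀ a → ¬ Joins T a a
  ¬Joins-self a joins with find joins
  ... | τ , τ∈T , inj₁ (refl , a≡e₂) = Finₚ.<-irrefl a≡e₂ (proj₁ (All.lookup valid τ∈T))
  ... | τ , τ∈T , inj₂ (refl , a≡e₁) = Finₚ.<-irrefl (sym a≡e₁) (proj₁ (All.lookup valid τ∈T))

  apexOf : ∀ {a b} → Joins T a b → Fin n
  apexOf = apex ∘ proj₁ ∘ find

  apexOf-∈ : ∀ {a b} (joins : Joins T a b) → apexOf joins ∈ apexes T
  apexOf-∈ joins = ∈-map⁺ apex (proj₁ (proj₂ (find joins)))

  ~apexOf₁ : ∀ {a b} (joins : Joins T a b) → a ~[ G ] apexOf joins
  ~apexOf₁ joins with find joins
  ... | τ , τ∈T , inj₁ (refl , _) = proj₁ (proj₂ (All.lookup valid τ∈T))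
  ... | τ , τ∈T , inj₂ (refl , _) = proj₂ (proj₂ (All.lookup valid τ∈T))

  ~apexOf₂ : ∀ {a b} (joins : Joins T a b) → b ~[ G ] apexOf joins
  ~apexOf₂ joins with find joins
  ... | τ , τ∈T , inj₁ (_ , refl) = proj₂ (proj₂ (All.lookup valid τ∈T))
  ... | τ , τ∈T , inj₂ (_ , refl) = proj₁ (proj₂ (All.lookup valid τ∈T))

  joinGraph : (U : List (Fin n)) → Graph (length U)
  joinGraph U = record
    { adj    = λ i j → does (joins? T (lookup U i) (lookup U j))
    ; sym    = λ i j → does-⇔ (mk⇔ Joins-sym Joins-sym) (joins? T _ _) (joins? T _ _)
    ; irrefl = λ i → dec-false (joins? T _ _) (¬Joins-self _)
    }

  joinGraph-edge⇒Joins : ∀ U {i j} → i ~[ joinGraph U ] j → Joins T (lookup U i) (lookup U j)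
  joinGraph-edge⇒Joins U {i} {j} e with joins? T (lookup U i) (lookup U j)
  ... | yes joins = joins
  ... | no _ with () ← e

  degree-joinGraph : ∀ U i → degree (joinGraph U) i ≡ count (joins? T (lookup U i)) U
  degree-joinGraph U i = trans (cong sum (map-lookup-allFin _ U)) (sum-map-if-does (joins? T (lookup U i)) U)

  degSum-joinGraph : ∀ U → degSum (joinGraph U) ≡ sum (map (λ u → count (joins? T u) U) U)
  degSum-joinGraph U = trans (cong sum (map-cong (degree-joinGraph U) (allFin (length U))))
    (cong sum (map-lookup-allFin (λ u → count (joins? T u) U) U))

  module _ (apexes-unique : Unique (apexes T)) where

    same-apex⇒same-ends : ∀ {a b c d} (j : Joins T a b) (k : Joins T c d) → apexOf j ≡ apexOf k →
      (a ≡ c × b ≡ d) ⊎ (a ≡ d × b ≡ c)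
    same-apex⇒same-ends j k eq with find j | find k
    ... | τ , τ∈T , ends | σ , σ∈T , ends′ with injective-on-map apex apexes-unique τ∈T σ∈T eq
    ...   | refl with ends | ends′
    ...     | inj₁ (refl , refl) | inj₁ (refl , refl) = inj₁ (refl , refl)
    ...     | inj₁ (refl , refl) | inj₂ (refl , refl) = inj₂ (refl , refl)
    ...     | inj₂ (refl , refl) | inj₁ (refl , refl) = inj₂ (refl , refl)
    ...     | inj₂ (refl , refl) | inj₂ (refl , refl) = inj₁ (refl , refl)

    apexOf-pairs-injective : ∀ {s} {a : Fin s → Fin n} → Injective _≡_ _≡_ a →
      (joins : ∀ i j → i Fin.< j → Joins T (a i) (a j)) →
      ∀ i j p i′ j′ p′ → apexOf (joins i j p) ≡ apexOf (joins i′ j′ p′) → i ≡ i′ × j ≡ j′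
    apexOf-pairs-injective a-injective joins i j p i′ j′ p′ eq
      with same-apex⇒same-ends (joins i j p) (joins i′ j′ p′) eq
    ... | inj₁ (ai≡ai′ , aj≡aj′) = a-injective ai≡ai′ , a-injective aj≡aj′
    ... | inj₂ (ai≡aj′ , aj≡ai′) with a-injective ai≡aj′ | a-injective aj≡ai′
    ...   | refl | refl = ⊥-elim (Finₚ.<-asym p p′)

    module _ (U : List (Fin n)) (U-unique : Unique U) (U∩apexes≡∅ : ∀ {u} → u ∈ U → u ∉ apexes T) where
      private
        f : SubdivV (joinGraph U) → Fin n
        f (orig i)      = lookup U i
        f (mid _ _ _ e) = apexOf (joinGraph-edge⇒Joins U e)

        apex∉U : ∀ i {j k} (e : j ~[ joinGraph U ] k) → lookup U i ≢ apexOf (joinGraph-edge⇒Joins U e)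
        apex∉U i e eq = U∩apexes≡∅ (∈-lookup i) (subst (_∈ apexes T) (sym eq) (apexOf-∈ (joinGraph-edge⇒Joins U e)))

        f-injective : Injective _≡_ _≡_ f
        f-injective {orig i}      {orig j}      eq = cong orig (lookup-injective U-unique eq)
        f-injective {orig i}      {mid _ _ _ e} eq = ⊥-elim (apex∉U i e eq)
        f-injective {mid _ _ _ e} {orig i}      eq = ⊥-elim (apex∉U i e (sym eq))
        f-injective {mid i j p e} {mid i′ j′ p′ e′} eq
          with same-apex⇒same-ends (joinGraph-edge⇒Joins U e) (joinGraph-edge⇒Joins U e′) eq
        ... | inj₁ (i≡i′ , j≡j′) with lookup-injective U-unique i≡i′ | lookup-injective U-unique j≡j′
        ...   | refl | refl with Finₚ.<-irrelevant p p′ | Decidable⇒UIP.≡-irrelevant Bool._≟_ e e′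
        ...     | refl | refl = refl
        f-injective {mid i j p e} {mid i′ j′ p′ e′} eq | inj₂ (i≡j′ , j≡i′)
          with lookup-injective U-unique i≡j′ | lookup-injective U-unique j≡i′
        ... | refl | refl = ⊥-elim (Finₚ.<-asym p p′)

        f-edge : ∀ u v → SubdivE (joinGraph U) u v → f u ~[ G ] f v
        f-edge _ _ (left₁ _ _ _ e)  = ~apexOf₁ (joinGraph-edge⇒Joins U e)
        f-edge _ _ (left₂ _ _ _ e)  = ~-sym G (~apexOf₁ (joinGraph-edge⇒Joins U e))
        f-edge _ _ (right₁ _ _ _ e) = ~apexOf₂ (joinGraph-edge⇒Joins U e)
        f-edge _ _ (right₂ _ _ _ e) = ~-sym G (~apexOf₂ (joinGraph-edge⇒Joins U e))

      joinGraph-subdivision : SubdivisionIn (joinGraph U) G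
      joinGraph-subdivision = f , f-injective , f-edge

    joinGraph-degenerate : ∀ {δ₁} → (∀ {m} (H : Graph m) → SubdivisionIn H G → AvgDegAtMost H δ₁) →
      ∀ {U} → Unique U → (∀ {u} → u ∈ U → u ∉ apexes T) → 0 ℕ.< length U →
      ∃[ u ] u ∈ U × count (joins? T u) U ≤ ∣ floor δ₁ ∣
    joinGraph-degenerate {δ₁} subdivision-sparse {U} !U U∩apexes≡∅ 0<|U|
      with i , deg≤ ← lowDegreeVertex (joinGraph U) {δ₁} 0<|U|
                        (subdivision-sparse (joinGraph U) (joinGraph-subdivision U !U U∩apexes≡∅))
      = lookup U i , ∈-lookup i , subst (_≤ ∣ floor δ₁ ∣) (degree-joinGraph U i) deg≤

handshake : ∀ {n} (T : List (Cherry n)) {U : List (Fin n)} → NewPairs T →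
  All (λ τ → end₁ τ ≢ end₂ τ × end₁ τ ∈ U × end₂ τ ∈ U) T →
  2 * length T ≤ sum (map (λ u → count (joins? T u) U) U)
handshake []      _            _ = z≤n
handshake {n} (τ ∷ T) {U} (new , news) ((e₁≢e₂ , e₁∈U , e₂∈U) ∷ ends∈U) = begin
  2 * suc (length T)                                         ≡⟨ *-suc 2 (length T) ⟩
  2 + 2 * length T                                           ≤⟨ +-mono-≤ two-ends (handshake T news ends∈U) ⟩
  sum (map (endsDegree τ) U) + sum (map (joinDegree T) U)    ≡⟨ sym (sum-map-+ (endsDegree τ) (joinDegree T) U) ⟩
  sum (map (λ u → endsDegree τ u + joinDegree T u) U)        ≤⟨ sum-map-mono U split ⟩
  sum (map (joinDegree (τ ∷ T)) U)                           ∎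
  where
  open ≤-Reasoning
  endsDegree : Cherry n → Fin n → ℕ
  endsDegree τ u = count (ends? τ u) U
  joinDegree : List (Cherry n) → Fin n → ℕ
  joinDegree T u = count (joins? T u) U
  two-ends : 2 ≤ sum (map (endsDegree τ) U)
  two-ends = ≤-trans (+-mono-≤ (count>0 (ends? τ (end₁ τ)) e₂∈U (inj₁ (refl , refl)))
                               (count>0 (ends? τ (end₂ τ)) e₁∈U (inj₂ (refl , refl))))
                     (∈∈⇒+≤sum-map (endsDegree τ) e₁≢e₂ e₁∈U e₂∈U)
  disjoint : ∀ u {x} → Ends τ u x → Joins T u x → ⊥
  disjoint u (inj₁ (refl , refl)) joins = new joins
  disjoint u (inj₂ (refl , refl)) joins = new (Joins-sym joins)
  split : ∀ u → endsDegree τ u + joinDegree T u ≤ joinDegree (τ ∷ T) u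
  split u = ≤-trans (count-∪-disjoint (ends? τ u) (joins? T u) U (disjoint u))
                    (count-mono (ends? τ u ∪? joins? T u) (joins? (τ ∷ T) u) U (λ _ → Sum.[ here , there ]))

record CherryDecomposition {n : ℕ} (G : Graph n) (L : List (Fin n)) : Set where
  field
    cherries       : List (Cherry n)
    rest           : List (Fin n)
    length-≡       : length cherries + length rest ≡ length L
    cherries-valid : All (IsCherry G) cherries
    apexes⊆L       : apexes cherries ⊆ L
    new-pairs      : NewPairs cherries
    apexes-unique  : Unique (apexes cherries)
    rest⊆L         : rest ⊆ L
    rest-unique    : Unique rest
    rest∉apexes    : ∀ {v} → v ∈ rest → v ∉ apexes cherries
    rest-saturated : ∀ {v} → v ∈ rest → ∀ {a b} → a Fin.< b → a ~[ G ] v → b ~[ G ] v → Joins cherries a b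

module _ {n : ℕ} (G : Graph n) where

  extendCherryDecomposition : ∀ {v L} → v ∉ L → CherryDecomposition G L → CherryDecomposition G (v ∷ L)
  extendCherryDecomposition {v} {L} v∉L D
    with Finₚ.any? (λ a → Finₚ.any? (λ b → a Fin.<? b ×-dec adjacent? G a v ×-dec adjacent? G b v
                                             ×-dec ¬? (joins? (CherryDecomposition.cherries D) a b)))
  ... | yes (a , b , a<b , a~v , b~v , new) = record
    { cherries       = cherry a b v ∷ cherries
    ; rest           = rest
    ; length-≡       = cong suc length-≡
    ; cherries-valid = (a<b , a~v , b~v) ∷ cherries-valid
    ; apexes⊆L       = λ { (here refl) → here refl ; (there w∈) → there (apexes⊆L w∈) }
    ; new-pairs      = new , new-pairs
    ; apexes-unique  = All.tabulate (λ w∈ v≡w → v∉L (subst (_∈ L) (sym v≡w) (apexes⊆L w∈))) ∷ apexes-unique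
    ; rest⊆L         = there ∘′ rest⊆L
    ; rest-unique    = rest-unique
    ; rest∉apexes    = λ { u∈ (here refl) → v∉L (rest⊆L u∈) ; u∈ (there u∈′) → rest∉apexes u∈ u∈′ }
    ; rest-saturated = λ u∈ a<b a~u b~u → there (rest-saturated u∈ a<b a~u b~u)
    }
    where open CherryDecomposition D
  ... | no saturated = record
    { cherries       = cherries
    ; rest           = v ∷ rest
    ; length-≡       = trans (+-suc (length cherries) (length rest)) (cong suc length-≡)
    ; cherries-valid = cherries-valid
    ; apexes⊆L       = there ∘′ apexes⊆L
    ; new-pairs      = new-pairs
    ; apexes-unique  = apexes-unique
    ; rest⊆L         = λ { (here refl) → here refl ; (there u∈) → there (rest⊆L u∈) }
    ; rest-unique    = All.tabulate (λ u∈ v≡u → v∉L (subst (_∈ L) (sym v≡u) (rest⊆L u∈))) ∷ rest-unique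
    ; rest∉apexes    = λ { (here refl) u∈ → v∉L (apexes⊆L u∈) ; (there u∈) → rest∉apexes u∈ }
    ; rest-saturated = λ { (here refl) → joined ; (there u∈) → rest-saturated u∈ }
    }
    where
    open CherryDecomposition D
    joined : ∀ {a b} → a Fin.< b → a ~[ G ] v → b ~[ G ] v → Joins cherries a b
    joined {a} {b} a<b a~v b~v with joins? cherries a b
    ... | yes joins = joins
    ... | no new    = ⊥-elim (saturated (a , b , a<b , a~v , b~v , new))

  cherryDecomposition : ∀ L → Unique L → CherryDecomposition G L
  cherryDecomposition [] _ = record
    { cherries = [] ; rest = [] ; length-≡ = refl ; cherries-valid = [] ; apexes⊆L = λ ()
    ; new-pairs = tt ; apexes-unique = [] ; rest⊆L = λ () ; rest-unique = []
    ; rest∉apexes = λ () ; rest-saturated = λ () }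
  cherryDecomposition (v ∷ L) (v∉L ∷ !L) =
    extendCherryDecomposition (λ v∈L → All.lookup v∉L v∈L refl) (cherryDecomposition L !L)

  rest-neighbours-joined : ∀ {L} (D : CherryDecomposition G L) → let open CherryDecomposition D in
    ∀ {v} → v ∈ rest → ∀ {a b} → a ~[ G ] v → b ~[ G ] v → a ≢ b → Joins cherries a b
  rest-neighbours-joined D v∈rest {a} {b} a~v b~v a≢b with Finₚ.<-cmp a b
  ... | tri< a<b _ _ = CherryDecomposition.rest-saturated D v∈rest a<b a~v b~v
  ... | tri≈ _ a≡b _ = ⊥-elim (a≢b a≡b)
  ... | tri> _ _ b<a = Joins-sym (CherryDecomposition.rest-saturated D v∈rest b<a b~v a~v)

-- Counting cliques in a degenerate graph

C-suc-mono : ∀ m r → m C r ≤ suc m C r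
C-suc-mono m zero    = ≤-refl
C-suc-mono m (suc r) = ≤-trans (m≤n+m (m C suc r) (m C r)) (≤-reflexive (nCk+nC[k+1]≡[n+1]C[k+1] m r))

C-monoˡ : ∀ r {m k} → m ≤′ k → m C r ≤ k C r
C-monoˡ r ≤′-refl               = ≤-refl
C-monoˡ r (≤′-step {k} m≤′k)    = ≤-trans (C-monoˡ r m≤′k) (C-suc-mono k r)

module CliqueCount {n : ℕ} (R : List (Fin n)) (K : Fin n → List (Fin n)) (s q : ℕ)
  (K-length : ∀ {v} → v ∈ R → length (K v) ≡ s) (K-unique : ∀ {v} → v ∈ R → Unique (K v)) where

  open import Data.List.Relation.Binary.Subset.DecPropositional (Fin._≟_ {n}) using (_⊆?_)
  open import Data.List.Membership.DecPropositional (Fin._≟_ {n}) using (_∈?_)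

  SameSet : List (Fin n) → Fin n → Set
  SameSet X v = X ⊆ K v × K v ⊆ X

  sameSet? : ∀ X v → Dec (SameSet X v)
  sameSet? X v = X ⊆? K v ×-dec K v ⊆? X

  Between : List (Fin n) → List (Fin n) → Fin n → Set
  Between X W v = X ⊆ K v × K v ⊆ X ++ W

  between? : ∀ X W v → Dec (Between X W v)
  between? X W v = X ⊆? K v ×-dec K v ⊆? X ++ W

  count-between≡0 : ∀ X W → (∀ {v} → v ∈ R → Between X W v → ⊥) → count (between? X W) R ≡ 0
  count-between≡0 X W never = cong length (filter-none (between? X W) (All.tabulate never))

  fibres-bounded : (∀ {v} → v ∈ R → count (sameSet? (K v)) R ≤ q) → ∀ X → count (sameSet? X) R ≤ q
  fibres-bounded fibre≤ X with Any.any? (sameSet? X) R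
  ... | no none = ≤-trans (≤-reflexive (cong length (filter-none (sameSet? X) (¬Any⇒All¬ R none)))) z≤n
  ... | yes some with v , v∈R , (X⊆Kv , Kv⊆X) ← find some =
    ≤-trans (count-mono (sameSet? X) (sameSet? (K v)) R (λ _ (X⊆Ku , Ku⊆X) → X⊆Ku ∘ Kv⊆X , X⊆Kv ∘ Ku⊆X))
            (fibre≤ v∈R)

  module _ (fibre≤ : ∀ X → count (sameSet? X) R ≤ q) where

    -- K v is determined by its r elements outside X, all taken from W, so the
    -- induction on W follows Pascal's rule.
    count-between≤ : ∀ W X r → Unique W → Unique X → (∀ {a} → a ∈ X → a ∉ W) → length X + r ≡ s →
      count (between? X W) R ≤ (length W C r) * q
    count-between≤ [] X zero _ _ _ _ = ≤-trans (count-mono (between? X []) (sameSet? X) R sameSet)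
                                              (≤-trans (fibre≤ X) (≤-reflexive (sym (+-identityʳ q))))
      where
      sameSet : ∀ {v} → v ∈ R → Between X [] v → SameSet X v
      sameSet _ (X⊆K , K⊆X) = X⊆K , subst (K _ ⊆_) (++-identityʳ X) K⊆X
    count-between≤ [] X (suc r) _ !X _ |X|+r≡s = ≤-reflexive (count-between≡0 X [] too-few)
      where
      too-few : ∀ {v} → v ∈ R → Between X [] v → ⊥
      too-few v∈R (_ , K⊆X) = <⇒≱ |X|<s (subst (_≤ length X) (K-length v∈R)
                                (unique-⊆⇒length≤ Fin._≟_ (K-unique v∈R) (subst (K _ ⊆_) (++-identityʳ X) K⊆X)))
        where
        |X|<s : length X ℕ.< s
        |X|<s = ≤-trans (s≤s (m≤m+n (length X) r)) (≤-reflexive (trans (sym (+-suc (length X) r)) |X|+r≡s))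
    count-between≤ (w ∷ W) X r (w∉W ∷ !W) !X X∩W≡∅ |X|+r≡s = begin
      count (between? X (w ∷ W)) R
        ≤⟨ count-mono (between? X (w ∷ W)) (between? (w ∷ X) W ∪? between? X W) R split ⟩
      count (between? (w ∷ X) W ∪? between? X W) R              ≤⟨ count-∪ (between? (w ∷ X) W) (between? X W) R ⟩
      count (between? (w ∷ X) W) R + count (between? X W) R     ≤⟨ bound r |X|+r≡s ⟩
      (suc (length W) C r) * q                                  ∎
      where
      open ≤-Reasoning
      !w∷X : Unique (w ∷ X)
      !w∷X = All.tabulate (λ a∈X w≡a → X∩W≡∅ a∈X (here (sym w≡a))) ∷ !X
      w∷X∩W≡∅ : ∀ {a} → a ∈ w ∷ X → a ∉ W
      w∷X∩W≡∅ (here refl) a∈W = All.lookup w∉W a∈W refl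
      w∷X∩W≡∅ (there a∈X) a∈W = X∩W≡∅ a∈X (there a∈W)
      X∩W≡∅′ : ∀ {a} → a ∈ X → a ∉ W
      X∩W≡∅′ a∈X a∈W = X∩W≡∅ a∈X (there a∈W)
      split : ∀ {v} → v ∈ R → Between X (w ∷ W) v → Between (w ∷ X) W v ⊎ Between X W v
      split {v} _ (X⊆K , K⊆X++w∷W) with w ∈? K v
      ... | yes w∈K = inj₁ (∈-∷⁺ʳ w∈K X⊆K , ⊆-respʳ-↭ (shift w X W) K⊆X++w∷W)
      ... | no w∉K  = inj₂ (X⊆K , ⊆∷∧∉⇒⊆ (⊆-respʳ-↭ (shift w X W) K⊆X++w∷W) w∉K)
      bound : ∀ r → length X + r ≡ s → count (between? (w ∷ X) W) R + count (between? X W) R ≤ (suc (length W) C r) * q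
      bound zero |X|≡s = ≤-trans (≤-reflexive (cong₂ _+_ (count-between≡0 (w ∷ X) W too-many) refl))
                                 (count-between≤ W X zero !W !X X∩W≡∅′ |X|≡s)
        where
        too-many : ∀ {v} → v ∈ R → Between (w ∷ X) W v → ⊥
        too-many v∈R (w∷X⊆K , _) = <-irrefl (trans (sym (+-identityʳ (length X))) |X|≡s)
          (subst (length (w ∷ X) ≤_) (K-length v∈R) (unique-⊆⇒length≤ Fin._≟_ !w∷X w∷X⊆K))
      bound (suc r) |X|+1+r≡s = begin
        count (between? (w ∷ X) W) R + count (between? X W) R
          ≤⟨ +-mono-≤ (count-between≤ W (w ∷ X) r !W !w∷X w∷X∩W≡∅ (trans (sym (+-suc (length X) r)) |X|+1+r≡s))
                      (count-between≤ W X (suc r) !W !X X∩W≡∅′ |X|+1+r≡s) ⟩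
        (length W C r) * q + (length W C suc r) * q            ≡⟨ sym (*-distribʳ-+ q (length W C r) (length W C suc r)) ⟩
        (length W C r + length W C suc r) * q                  ≡⟨ cong (_* q) (nCk+nC[k+1]≡[n+1]C[k+1] (length W) r) ⟩
        (suc (length W) C suc r) * q                            ∎

    module _ {_E_ : Fin n → Fin n → Set} (_E?_ : ∀ a b → Dec (a E b)) (E-irrefl : ∀ {a} → ¬ a E a)
      (K-clique : ∀ {v} → v ∈ R → ∀ {a b} → a ∈ K v → b ∈ K v → a ≢ b → a E b)
      (Vs : List (Fin n)) (d : ℕ)
      (degenerate : ∀ {U} → Unique U → U ⊆ Vs → 0 ℕ.< length U → ∃[ u ] u ∈ U × count (u E?_) U ≤ d)
      (1≤s : 1 ≤ s) where

      private
        M : ℕ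
        M = (d C (s ∸ 1)) * q

        -- Remove a vertex u of low degree: the cliques through u lie in u and its
        -- at most d neighbours, the others avoid u.
        bounded : ∀ k {U} → length U ≤ k → Unique U → U ⊆ Vs → count (λ v → K v ⊆? U) R ≤ M * length U
        bounded _ {[]} _ _ _ = ≤-reflexive (trans (cong length (filter-none _ (All.tabulate K⊈[]))) (sym (*-zeroʳ M)))
          where
          K⊈[] : ∀ {v} → v ∈ R → ¬ K v ⊆ []
          K⊈[] v∈R K⊆[] = <⇒≢ 1≤s (trans (sym (cong length (⊆[]⇒≡[] K⊆[]))) (K-length v∈R))
        bounded (suc k) {U@(_ ∷ _)} (s≤s |U|≤1+k) !U U⊆Vs with degenerate !U U⊆Vs (s≤s z≤n)
        ... | u , u∈U , deg≤d = begin
          count (λ v → K v ⊆? U) R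
            ≤⟨ count-mono (λ v → K v ⊆? U) (between? [ u ] N ∪? (λ v → K v ⊆? U′)) R split ⟩
          count (between? [ u ] N ∪? (λ v → K v ⊆? U′)) R           ≤⟨ count-∪ (between? [ u ] N) (λ v → K v ⊆? U′) R ⟩
          count (between? [ u ] N) R + count (λ v → K v ⊆? U′) R   ≤⟨ +-mono-≤ through-u avoiding-u ⟩
          M + M * length U′                                        ≡⟨ sym (*-suc M (length U′)) ⟩
          M * suc (length U′)                                      ≤⟨ *-monoʳ-≤ M (length-remove< Fin._≟_ U u∈U) ⟩
          M * length U                                             ∎
          where
          open ≤-Reasoning
          N U′ : List (Fin n)
          N = filter (u E?_) U
          U′ = remove Fin._≟_ u U
          |U′|≤k : length U′ ≤ k
          |U′|≤k = ≤-pred (≤-trans (length-remove< Fin._≟_ U u∈U) (s≤s |U|≤1+k))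
          u∉N : u ∉ N
          u∉N u∈N = E-irrefl (proj₂ (∈-filter⁻ (u E?_) {xs = U} u∈N))
          avoiding-u : count (λ v → K v ⊆? U′) R ≤ M * length U′
          avoiding-u = bounded k |U′|≤k (remove-unique Fin._≟_ u !U) (U⊆Vs ∘ remove-⊆ Fin._≟_ u U)
          through-u : count (between? [ u ] N) R ≤ M
          through-u = ≤-trans (count-between≤ N [ u ] (s ∸ 1) (Unique.filter⁺ (u E?_) !U) (All.[] ∷ [])
                                (λ { (here refl) → u∉N }) (m+[n∸m]≡n 1≤s))
                              (*-monoˡ-≤ q (C-monoˡ (s ∸ 1) (≤⇒≤′ deg≤d)))
          split : ∀ {v} → v ∈ R → K v ⊆ U → Between [ u ] N v ⊎ K v ⊆ U′
          split {v} v∈R K⊆U with u ∈? K v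
          ... | yes u∈K = inj₁ ((λ { (here refl) → u∈K }) , K⊆u∷N)
            where
            K⊆u∷N : K v ⊆ u ∷ N
            K⊆u∷N {a} a∈K with u Fin.≟ a
            ... | yes refl = here refl
            ... | no u≢a   = there (∈-filter⁺ (u E?_) (K⊆U a∈K) (K-clique v∈R u∈K a∈K u≢a))
          ... | no u∉K = inj₂ λ {a} a∈K →
                  ∈-remove⁺ Fin._≟_ (K⊆U a∈K) (λ u≡a → u∉K (subst (_∈ K v) (sym u≡a) a∈K))

      count-⊆≤ : ∀ {U} → Unique U → U ⊆ Vs → count (λ v → K v ⊆? U) R ≤ (d C (s ∸ 1)) * q * length U
      count-⊆≤ {U} = bounded (length U) ≤-refl

s≡1⇒ContainsKStar : ∀ {n} (G : Graph n) {s t} δ δ₁ → s ≡ 1 → 1 ≤ t → ∀ {u v} → u ~[ G ] v →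
  ¬ HasLightEdge G (floor (N₁ s t δ δ₁)) → ContainsKStar G s t
s≡1⇒ContainsKStar G {t = t} δ δ₁ refl 1≤t {u} {v} u~v noLightEdge with Finₚ.any? (λ w → t ≤? degree G w)
... | yes (w , t≤deg) = star⇒ContainsKStar G w t≤deg
... | no ¬large = ⊥-elim (noLightEdge (u , v , u~v , light u , light v))
  where
  light : ∀ w → + degree G w ℤ.≤ floor (N₁ 1 t δ δ₁)
  light w = ≤⇒≤floor (degree G w) _ (subst (ℕ→ℚ (degree G w) ℚ.≤_) (ℕ→ℚ-pred t 1≤t)
              (ℕ→ℚ-mono-≤ (<⇒≤pred (≰⇒> (λ t≤deg → ¬large (w , t≤deg))))))

N₁-pairs : ∀ {s} t δ δ₁ → s ≡ 2 →
  (δ ℚ.- ℕ→ℚ s) ℚ.* (½ ℚ.* δ₁ ℚ.* ℕ→ℚ t) ℚ.+ δ ≡ N₁ s t δ δ₁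
N₁-pairs t δ δ₁ refl = regroup δ (ℕ→ℚ 2) ½ δ₁ (ℕ→ℚ t)
  where
  open +-*-Solver
  regroup : ∀ δ two h d t → (δ ℚ.- two) ℚ.* (h ℚ.* d ℚ.* t) ℚ.+ δ ≡ h ℚ.* (δ ℚ.- two) ℚ.* d ℚ.* t ℚ.+ δ
  regroup = solve 5 (λ δ two h d t → (δ :- two) :* (h :* d :* t) :+ δ := h :* (δ :- two) :* d :* t :+ δ) refl

N₁-cliques : ∀ {s} k t δ δ₁ → s ≡ 3 + k →
  (δ ℚ.- ℕ→ℚ s) ℚ.* (ℕ→ℚ ((∣ floor δ₁ ∣ C (s ∸ 1)) * (t ∸ 1)) ℚ.+ ½ ℚ.* δ₁) ℚ.+ δ ≡ N₁ s t δ δ₁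
N₁-cliques k t δ δ₁ refl = refl

one-two-or-more : ∀ s → 1 ≤ s → s ≡ 1 ⊎ s ≡ 2 ⊎ ∃[ k ] s ≡ 3 + k
one-two-or-more 1                   _ = inj₁ refl
one-two-or-more 2                   _ = inj₂ (inj₁ refl)
one-two-or-more (suc (suc (suc k))) _ = inj₂ (inj₂ (k , refl))

module NoLowVertexNoLightEdge
  (s t : ℕ) (1≤s : 1 ≤ s) (1≤t : 1 ≤ t) (δ δ₁ : ℚ) {n : ℕ} (G : Graph n) (1≤n : 1 ≤ n)
  (G-sparse : AvgDegAtMost G δ)
  (subdivision-sparse : ∀ {m} (H : Graph m) → SubdivisionIn H G → AvgDegAtMost H δ₁)
  (minDegree : ∀ v → s ≤ degree G v)
  (noLightEdge : ¬ HasLightEdge G (floor (N₁ s t δ δ₁)))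
  where

  Light : Fin n → Set
  Light v = + degree G v ℤ.≤ floor (N₁ s t δ δ₁)

  light? : ∀ v → Dec (Light v)
  light? v = + degree G v ℤ.≤? floor (N₁ s t δ δ₁)

  light-light⇒⊥ : ∀ {u v} → u ~[ G ] v → Light u → ¬ Light v
  light-light⇒⊥ u~v light-u light-v = noLightEdge (_ , _ , u~v , light-u , light-v)

  v₀ : Fin n
  v₀ = Fin.fromℕ< 1≤n

  w₀ : Fin n
  w₀ = proj₁ (neighbour G v₀ (≤-trans 1≤s (minDegree v₀)))

  v₀~w₀ : v₀ ~[ G ] w₀
  v₀~w₀ = proj₂ (neighbour G v₀ (≤-trans 1≤s (minDegree v₀)))

  lights heavies : List (Fin n)
  lights  = filter light? (allFin n)
  heavies = filter (∁? light?) (allFin n)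

  ∈-lights⁻ : ∀ {v} → v ∈ lights → Light v
  ∈-lights⁻ = proj₂ ∘ ∈-filter⁻ light? {xs = allFin n}

  ∈-heavies⁻ : ∀ {v} → v ∈ heavies → ¬ Light v
  ∈-heavies⁻ = proj₂ ∘ ∈-filter⁻ (∁? light?) {xs = allFin n}

  ∈-heavies⁺ : ∀ {v} → ¬ Light v → v ∈ heavies
  ∈-heavies⁺ = ∈-filter⁺ (∁? light?) (∈-allFin _)

  heavies-unique : Unique heavies
  heavies-unique = Unique.filter⁺ (∁? light?) (Unique.allFin⁺ n)

  some-heavy : ∃[ v ] v ∈ heavies
  some-heavy with light? v₀
  ... | yes light-v₀ = w₀ , ∈-heavies⁺ (light-light⇒⊥ v₀~w₀ light-v₀)
  ... | no heavy-v₀  = v₀ , ∈-heavies⁺ heavy-v₀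

  decomposition : CherryDecomposition G lights
  decomposition = cherryDecomposition G lights (Unique.filter⁺ light? (Unique.allFin⁺ n))

  open CherryDecomposition decomposition
  open CherryGraph G cherries cherries-valid

  heavies∩apexes≡∅ : ∀ {v} → v ∈ heavies → v ∉ apexes cherries
  heavies∩apexes≡∅ v∈heavies v∈apexes = ∈-heavies⁻ v∈heavies (∈-lights⁻ (apexes⊆L v∈apexes))

  K : Fin n → List (Fin n)
  K v = take s (neighbours G v)

  K-length : ∀ {v} → v ∈ rest → length (K v) ≡ s
  K-length {v} _ = trans (length-take s (neighbours G v))
    (m≤n⇒m⊓n≡m (subst (s ≤_) (sym (length-neighbours G v)) (minDegree v)))

  K-unique : ∀ {v} → v ∈ rest → Unique (K v)
  K-unique {v} _ = Unique.take⁺ s (neighbours-unique G v)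

  ~K : ∀ {v a} → a ∈ K v → v ~[ G ] a
  ~K {v} = ∈-neighbours⁻ G ∘ take-⊆ s (neighbours G v)

  K-heavy : ∀ {v a} → v ∈ rest → a ∈ K v → ¬ Light a
  K-heavy v∈rest a∈K = light-light⇒⊥ (~K a∈K) (∈-lights⁻ (rest⊆L v∈rest))

  K-clique : ∀ {v} → v ∈ rest → ∀ {a b} → a ∈ K v → b ∈ K v → a ≢ b → Joins cherries a b
  K-clique v∈rest a∈K b∈K = rest-neighbours-joined G decomposition v∈rest (~-sym G (~K a∈K)) (~-sym G (~K b∈K))

  open CliqueCount rest K s (t ∸ 1) K-length K-unique
  open import Data.List.Relation.Binary.Subset.DecPropositional (Fin._≟_ {n}) using (_⊆?_)

  module _ {v} (v∈rest : v ∈ rest) (t≤fibre : t ≤ count (sameSet? (K v)) rest) where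
    private
      s≤|K| : s ≤ length (K v)
      s≤|K| = ≤-reflexive (sym (K-length v∈rest))

      a : Fin s → Fin n
      a = pick (K v) s≤|K|

      a∈K : ∀ i → a i ∈ K v
      a∈K = pick-∈ (K v) s≤|K|

      a-injective : ∀ {i j} → a i ≡ a j → i ≡ j
      a-injective = pick-injective s≤|K| (K-unique v∈rest)

      b : Fin t → Fin n
      b = pick (filter (sameSet? (K v)) rest) t≤fibre

      b∈fibre : ∀ j → b j ∈ rest × SameSet (K v) (b j)
      b∈fibre j = ∈-filter⁻ (sameSet? (K v)) {xs = rest} (pick-∈ (filter (sameSet? (K v)) rest) t≤fibre j)

      joins : ∀ i j → i Fin.< j → Joins cherries (a i) (a j)
      joins i j i<j = K-clique v∈rest (a∈K i) (a∈K j) (Finₚ.<⇒≢ i<j ∘ a-injective)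

      c : ∀ i j → i Fin.< j → Fin n
      c i j i<j = apexOf (joins i j i<j)

    large-fibre⇒ContainsKStar : ContainsKStar G s t
    large-fibre⇒ContainsKStar = KStarImage⇒ContainsKStar G (record
      { a = a ; b = b ; c = c
      ; a-injective = a-injective
      ; b-injective = pick-injective t≤fibre (Unique.filter⁺ (sameSet? (K v)) rest-unique)
      ; c-injective = apexOf-pairs-injective apexes-unique a-injective joins
      ; a≢b  = λ i j a≡b → K-heavy v∈rest (a∈K i)
                 (subst Light (sym a≡b) (∈-lights⁻ (rest⊆L (proj₁ (b∈fibre j)))))
      ; a≢c  = λ i j k p a≡c → K-heavy v∈rest (a∈K i)
                 (subst Light (sym a≡c) (∈-lights⁻ (apexes⊆L (apexOf-∈ (joins j k p)))))
      ; b≢c  = λ i j k p b≡c → rest∉apexes (proj₁ (b∈fibre i))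
                 (subst (_∈ apexes cherries) (sym b≡c) (apexOf-∈ (joins j k p)))
      ; a~b  = λ i j → ~-sym G (~K (proj₁ (proj₂ (b∈fibre j)) (a∈K i)))
      ; c~a₁ = λ i j p → ~-sym G (~apexOf₁ (joins i j p))
      ; c~a₂ = λ i j p → ~-sym G (~apexOf₂ (joins i j p))
      })

  -- σB ≤ δ n − s |lights| ≤ ((δ − s) c + δ) |heavies| = N₁ |heavies| < σB
  degree-budget⇒⊥ : (c : ℚ) → (δ ℚ.- ℕ→ℚ s) ℚ.* c ℚ.+ δ ≡ N₁ s t δ δ₁ →
    ℕ→ℚ (length lights) ℚ.≤ c ℚ.* ℕ→ℚ (length heavies) → ⊥
  degree-budget⇒⊥ c N₁≡ a≤cb = ℚₚ.<-irrefl refl (ℚₚ.<-≤-trans N₁b<σB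
    (subst (λ q → ℕ→ℚ σB ℚ.≤ q ℚ.* ℕ→ℚ (length heavies)) N₁≡
      (split-degree-bound δ (ℕ→ℚ s) c (ℕ→ℚ (length lights)) (ℕ→ℚ (length heavies)) (ℕ→ℚ σS) (ℕ→ℚ σB)
        σS+σB≤δn s*a≤σS s≤δ a≤cb)))
    where
    σS σB : ℕ
    σS = sum (map (degree G) lights)
    σB = sum (map (degree G) heavies)

    σS+σB≤δn : ℕ→ℚ σS ℚ.+ ℕ→ℚ σB ℚ.≤ δ ℚ.* (ℕ→ℚ (length lights) ℚ.+ ℕ→ℚ (length heavies))
    σS+σB≤δn = subst₂ ℚ._≤_
      (trans (cong ℕ→ℚ (sym (sum-map-filter+filter-∁ light? (degree G) (allFin n)))) (ℕ→ℚ-+ σS σB))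
      (cong (δ ℚ.*_) (trans (cong ℕ→ℚ n≡a+b) (ℕ→ℚ-+ (length lights) (length heavies))))
      G-sparse
      where
      n≡a+b : n ≡ length lights + length heavies
      n≡a+b = trans (sym (length-tabulate {n = n} (λ i → i))) (sym (count+count-∁≡length light? (allFin n)))

    s*a≤σS : ℕ→ℚ s ℚ.* ℕ→ℚ (length lights) ℚ.≤ ℕ→ℚ σS
    s*a≤σS = subst (ℚ._≤ ℕ→ℚ σS) (ℕ→ℚ-* s (length lights))
      (ℕ→ℚ-mono-≤ (sum-map-≥ lights (λ {v} _ → minDegree v)))

    s≤δ : ℕ→ℚ s ℚ.≤ δ
    s≤δ = minDegree≤avgDegree G 1≤n G-sparse minDegree

    N₁b<σB : N₁ s t δ δ₁ ℚ.* ℕ→ℚ (length heavies) ℚ.< ℕ→ℚ σB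
    N₁b<σB = sum-map-> (degree G) (N₁ s t δ δ₁) heavies (proj₂ some-heavy)
      (λ {v} v∈heavies → floor<⇒< (degree G v) _ (ℤₚ.≰⇒> (∈-heavies⁻ v∈heavies)))

  module _ (fibre≤ : ∀ X → count (sameSet? X) rest ≤ t ∸ 1) where

    2T≤δ₁b : ℕ→ℚ (2 * length cherries) ℚ.≤ δ₁ ℚ.* ℕ→ℚ (length heavies)
    2T≤δ₁b = ℚₚ.≤-trans
      (ℕ→ℚ-mono-≤ (≤-trans (handshake cherries new-pairs ends-heavy) (≤-reflexive (sym (degSum-joinGraph heavies)))))
      (subdivision-sparse (joinGraph heavies) (joinGraph-subdivision apexes-unique heavies heavies-unique heavies∩apexes≡∅))
      where
      ends-heavy : All (λ τ → end₁ τ ≢ end₂ τ × end₁ τ ∈ heavies × end₂ τ ∈ heavies) cherries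
      ends-heavy = All.tabulate λ {τ} τ∈ →
        let (e₁<e₂ , e₁~apex , e₂~apex) = All.lookup cherries-valid τ∈
            light-apex = ∈-lights⁻ (apexes⊆L (∈-map⁺ apex τ∈))
        in Finₚ.<⇒≢ e₁<e₂
         , ∈-heavies⁺ (λ light-e₁ → light-light⇒⊥ e₁~apex light-e₁ light-apex)
         , ∈-heavies⁺ (λ light-e₂ → light-light⇒⊥ e₂~apex light-e₂ light-apex)

    rest≤pairs : s ≡ 2 → length rest ≤ (t ∸ 1) * length cherries
    rest≤pairs s≡2 = begin
      length rest                                 ≤⟨ length≤sum-map-count sameSet? pairs rest covered ⟩
      sum (map (λ X → count (sameSet? X) rest) pairs) ≤⟨ sum-map-≤ pairs (λ {X} _ → fibre≤ X) ⟩
      (t ∸ 1) * length pairs                      ≡⟨ cong ((t ∸ 1) *_) (length-map endpoints cherries) ⟩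
      (t ∸ 1) * length cherries                   ∎
      where
      open ≤-Reasoning
      pairs : List (List (Fin n))
      pairs = map endpoints cherries
      covered : ∀ {v} → v ∈ rest → Any (λ X → SameSet X v) pairs
      covered v∈rest = Any.map⁺
        (joined-pair⇒endpoints cherries (trans (K-length v∈rest) s≡2) (K-unique v∈rest) (K-clique v∈rest))

    rest≤cliques : length rest ≤ (∣ floor δ₁ ∣ C (s ∸ 1)) * (t ∸ 1) * length heavies
    rest≤cliques = begin
      length rest                                 ≡⟨ sym (cong length (filter-all (λ v → K v ⊆? heavies) K⊆heavies)) ⟩
      count (λ v → K v ⊆? heavies) rest
        ≤⟨ count-⊆≤ fibre≤ (joins? cherries) (¬Joins-self _) K-clique heavies ∣ floor δ₁ ∣ degenerate 1≤s
                    heavies-unique (λ v∈ → v∈) ⟩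
      (∣ floor δ₁ ∣ C (s ∸ 1)) * (t ∸ 1) * length heavies ∎
      where
      open ≤-Reasoning
      K⊆heavies : All (λ v → K v ⊆ heavies) rest
      K⊆heavies = All.tabulate (λ v∈rest a∈K → ∈-heavies⁺ (K-heavy v∈rest a∈K))
      degenerate : ∀ {U} → Unique U → U ⊆ heavies → 0 ℕ.< length U →
        ∃[ u ] u ∈ U × count (joins? cherries u) U ≤ ∣ floor δ₁ ∣
      degenerate !U U⊆heavies =
        joinGraph-degenerate apexes-unique {δ₁} subdivision-sparse !U (heavies∩apexes≡∅ ∘ U⊆heavies)

    small-fibres⇒⊥ : s ≡ 2 ⊎ ∃[ k ] s ≡ 3 + k → ⊥
    small-fibres⇒⊥ (inj₁ s≡2) = degree-budget⇒⊥ c (N₁-pairs t δ δ₁ s≡2) a≤cb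
      where
      c : ℚ
      c = ½ ℚ.* δ₁ ℚ.* ℕ→ℚ t
      a≤cb : ℕ→ℚ (length lights) ℚ.≤ c ℚ.* ℕ→ℚ (length heavies)
      a≤cb = subst (λ a → ℕ→ℚ a ℚ.≤ c ℚ.* ℕ→ℚ (length heavies)) length-≡
        (pair-count-bound δ₁ t (length cherries) (length rest) (length heavies) 1≤t 2T≤δ₁b (rest≤pairs s≡2))
    small-fibres⇒⊥ (inj₂ (k , s≡3+k)) = degree-budget⇒⊥ c (N₁-cliques k t δ δ₁ s≡3+k) a≤cb
      where
      c : ℚ
      c = ℕ→ℚ ((∣ floor δ₁ ∣ C (s ∸ 1)) * (t ∸ 1)) ℚ.+ ½ ℚ.* δ₁
      a≤cb : ℕ→ℚ (length lights) ℚ.≤ c ℚ.* ℕ→ℚ (length heavies)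
      a≤cb = subst (λ a → ℕ→ℚ a ℚ.≤ c ℚ.* ℕ→ℚ (length heavies)) length-≡
        (clique-count-bound δ₁ ((∣ floor δ₁ ∣ C (s ∸ 1)) * (t ∸ 1)) (length cherries) (length rest) (length heavies)
          2T≤δ₁b rest≤cliques)

  containsKStar : ContainsKStar G s t
  containsKStar with one-two-or-more s 1≤s
  ... | inj₁ s≡1 = s≡1⇒ContainsKStar G δ δ₁ s≡1 1≤t v₀~w₀ noLightEdge
  ... | inj₂ s≥2 with Any.any? (λ v → t ≤? count (sameSet? (K v)) rest) rest
  ...   | yes large = let v , v∈rest , t≤fibre = find large in large-fibre⇒ContainsKStar v∈rest t≤fibre
  ...   | no ¬large = ⊥-elim (small-fibres⇒⊥ (fibres-bounded small) s≥2)
    where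
    small : ∀ {v} → v ∈ rest → count (sameSet? (K v)) rest ≤ t ∸ 1
    small v∈rest = <⇒≤pred (≰⇒> (¬large ∘ lose v∈rest))

lemma3 : (s t : ℕ) → 1 ≤ s → 1 ≤ t → (δ δ₁ : ℚ) → 0ℚ < δ → 0ℚ < δ₁ →
    ∀ {n} (G : Graph n) → 1 ≤ n →
    (∀ {m} (H : Graph m) → H ⊆G G → AvgDegAtMost H δ) →
    (∀ {m} (H : Graph m) → SubdivisionIn H G → AvgDegAtMost H δ₁) →
    ContainsKStar G s t
      ⊎ (∃[ v ] degree G v ≤ s ∸ 1)
      ⊎ HasLightEdge G (floor (N₁ s t δ δ₁))
lemma3 s t 1≤s 1≤t δ δ₁ _ _ G 1≤n sparse subdivision-sparse
  with Finₚ.any? (λ v → degree G v ≤? s ∸ 1) | hasLightEdge? G (floor (N₁ s t δ δ₁))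
... | yes low    | _          = inj₂ (inj₁ low)
... | no _       | yes light  = inj₂ (inj₂ light)
... | no no-low  | no ¬light  = inj₁ (NoLowVertexNoLightEdge.containsKStar
        s t 1≤s 1≤t δ δ₁ G 1≤n (sparse G (⊆G-refl G)) subdivision-sparse minDegree ¬light)
  where
  minDegree : ∀ v → s ≤ degree G v
  minDegree v = ≮⇒≥ (λ deg<s → no-low (v , <⇒≤pred deg<s))
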